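{- For each odd prime $p$, as $K\to\infty$, $$\rho_p(K):=\frac{\#\{(k_2,h)\in\mathcal{I}_K:\ p\mid d(k_2,h)\}}{|\mathcal{I}_K|}=\frac1p+O_p(K^{ -1}).$$
   Context: For a positive integer $K$, $\mathcal{I}_K:=\{(k_2,h)\in\mathbb{Z}^2:\ 1\le h\le K-1,\ h \text{ even},\ 1\le k_2\le K-h\}$, and $d(k_2,h):=2^{k_2}(2^h-1)-h$. The implied constant in $O_p$ may depend on $p$. -}

module Defs where

open import Data.Nat as ℕ using (ℕ; zero; suc; _≤_; _∸_; _≤?_)
open import Data.Nat.Divisibility as ℕD using ()
open import Data.Integer as ℤ using (ℤ; +_)
open import Data.Integer.Divisibility.Signed as ℤD using ()
open import Data.Product using (_×_; _,_)
open import Data.List using (List; filter; cartesianProduct; upTo; length)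
open import Relation.Nullary using (Dec; _×-dec_)
open import Data.Rational as ℚ using (ℚ; _/_; 0ℚ)

InI : ℕ → ℕ × ℕ → Set
InI K (k₂ , h) = (1 ≤ h) × (h ≤ K ∸ 1) × (2 ℕD.∣ h) × (1 ≤ k₂) × (k₂ ≤ K ∸ h)

InI? : (K : ℕ) → (x : ℕ × ℕ) → Dec (InI K x)
InI? K (k₂ , h) =
  (1 ≤? h) ×-dec (h ≤? K ∸ 1) ×-dec (2 ℕD.∣? h) ×-dec (1 ≤? k₂) ×-dec (k₂ ≤? K ∸ h)

IK : ℕ → List (ℕ × ℕ)
IK K = filter (InI? K) (cartesianProduct (upTo (suc K)) (upTo (suc K)))

d : ℕ → ℕ → ℤ
d k₂ h = (+ 2) ℤ.^ k₂ ℤ.* ((+ 2) ℤ.^ h ℤ.- ℤ.1ℤ) ℤ.- + h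

divSet : ℕ → ℕ → List (ℕ × ℕ)
divSet p K = filter (λ { (k₂ , h) → (+ p) ℤD.∣? d k₂ h }) (IK K)

-- a / b as a rational; (conventionally 0 when b = 0, never used for b = 0 below)
frac : ℕ → ℕ → ℚ
frac a zero = 0ℚ
frac a (suc b) = (+ a) / suc b

ρ : ℕ → ℕ → ℚ
ρ p K = frac (length (divSet p K)) (length (IK K))

-- For an odd prime p there is an even σ with 2^σ ≡ 1 and σ ≡ -1 (mod p): take a period T < p of 2
-- modulo p (pigeonhole on the nonzero residues of 2ⁱ) and solve 2Tw ≡ -1 by Bézout, σ = 2Tw.
-- Then h ↦ h + jσ preserves parity and d(k₂, h + jσ) ≡ d(k₂, h) + j (mod p), so among the even h of
-- any pσ consecutive integers exactly a fraction 1/p has p ∣ d(k₂, h). A row of I_K (fixed k₂) is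
-- the set of even h in an interval, so its number of h with p ∣ d is within O(pσ) of 1/p of its
-- size. Summing over the K rows, |p · #{p ∣ d} − |I_K|| = O(K), while |I_K| ≥ K²/8.
module Submission where

open import Defs

module FiniteSums where

  open import Data.Nat using (ℕ; zero; suc; _+_; _*_; _∸_; _≤_; _<_; z≤n; z<s; s<s; NonZero)
  open import Data.Nat.Properties
  open import Data.Nat.DivMod using (_/_; _%_; m≡m%n+[m/n]*n; m%n<n)
  import Data.Nat.Tactic.RingSolver as ℕ-Ring
  open import Algebra.Properties.CommutativeSemigroup +-commutativeSemigroup using (interchange)
  open import Data.Bool using (true; false)
  open import Data.Product using (_×_; _,_)
  open import Data.Empty using (⊥-elim)
  open import Data.List using (List; []; _∷_; _++_; map; filter; length; applyUpTo; cartesianProduct)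
  open import Data.List.Properties using (filter-++; length-++; map-applyUpTo)
  open import Function using (_∘_)
  open import Relation.Nullary using (Dec; yes; no; _because_; ¬_; _×-dec_)
  open import Relation.Unary using (Pred; Decidable)
  open import Relation.Unary.Properties using (_∩?_)
  open import Relation.Binary.PropositionalEquality

  -- Matches on `does` only, so it computes as soon as the decision procedure does.
  𝟙 : ∀ {a} {P : Set a} → Dec P → ℕ
  𝟙 (true  because _) = 1
  𝟙 (false because _) = 0

  module _ {a b} {P : Set a} {Q : Set b} where

    𝟙-cong : (P → Q) → (Q → P) → (P? : Dec P) (Q? : Dec Q) → 𝟙 P? ≡ 𝟙 Q?
    𝟙-cong _ _ (yes _) (yes _) = refl
    𝟙-cong f _ (yes p) (no ¬q) = ⊥-elim (¬q (f p))
    𝟙-cong _ g (no ¬p) (yes q) = ⊥-elim (¬p (g q))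
    𝟙-cong _ _ (no _)  (no _)  = refl

    𝟙-×-dec : (P? : Dec P) (Q? : Dec Q) → 𝟙 (P? ×-dec Q?) ≡ 𝟙 P? * 𝟙 Q?
    𝟙-×-dec (yes _) (yes _) = refl
    𝟙-×-dec (yes _) (no _)  = refl
    𝟙-×-dec (no _)  _       = refl

  module _ {a} {P : Set a} where

    𝟙-yes : P → (P? : Dec P) → 𝟙 P? ≡ 1
    𝟙-yes _ (yes _) = refl
    𝟙-yes p (no ¬p) = ⊥-elim (¬p p)

    𝟙-no : ¬ P → (P? : Dec P) → 𝟙 P? ≡ 0
    𝟙-no ¬p (yes p) = ⊥-elim (¬p p)
    𝟙-no _  (no _)  = refl

    𝟙≤1 : (P? : Dec P) → 𝟙 P? ≤ 1
    𝟙≤1 (yes _) = ≤-refl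
    𝟙≤1 (no _)  = z≤n

  ∑< : ℕ → (ℕ → ℕ) → ℕ
  ∑< zero    f = 0
  ∑< (suc n) f = f 0 + ∑< n (f ∘ suc)

  syntax ∑< n (λ i → e) = ∑[ i < n ] e

  ∑-cong : ∀ n {f g : ℕ → ℕ} → (∀ i → i < n → f i ≡ g i) → ∑[ i < n ] f i ≡ ∑[ i < n ] g i
  ∑-cong zero    eq = refl
  ∑-cong (suc n) eq = cong₂ _+_ (eq 0 z<s) (∑-cong n (λ i i<n → eq (suc i) (s<s i<n)))

  ∑-mono-≤ : ∀ n {f g : ℕ → ℕ} → (∀ i → f i ≤ g i) → ∑[ i < n ] f i ≤ ∑[ i < n ] g i
  ∑-mono-≤ zero    le = z≤n
  ∑-mono-≤ (suc n) le = +-mono-≤ (le 0) (∑-mono-≤ n (le ∘ suc))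

  ∑-const : ∀ n c → ∑[ i < n ] c ≡ n * c
  ∑-const zero    c = refl
  ∑-const (suc n) c = cong (c +_) (∑-const n c)

  ∑-zero : ∀ n {f : ℕ → ℕ} → (∀ i → i < n → f i ≡ 0) → ∑[ i < n ] f i ≡ 0
  ∑-zero n eq = trans (∑-cong n eq) (trans (∑-const n 0) (*-zeroʳ n))

  ∑-split : ∀ m n (f : ℕ → ℕ) → ∑[ i < m + n ] f i ≡ ∑[ i < m ] f i + ∑[ i < n ] f (m + i)
  ∑-split zero    n f = refl
  ∑-split (suc m) n f = trans (cong (f 0 +_) (∑-split m n (f ∘ suc))) (sym (+-assoc (f 0) _ _))

  ∑-distrib-+ : ∀ n (f g : ℕ → ℕ) → ∑[ i < n ] (f i + g i) ≡ ∑[ i < n ] f i + ∑[ i < n ] g i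
  ∑-distrib-+ zero    f g = refl
  ∑-distrib-+ (suc n) f g = trans (cong (f 0 + g 0 +_) (∑-distrib-+ n (f ∘ suc) (g ∘ suc)))
                                  (interchange (f 0) (g 0) _ _)

  ∑-distribˡ-* : ∀ n c (f : ℕ → ℕ) → ∑[ i < n ] (c * f i) ≡ c * ∑[ i < n ] f i
  ∑-distribˡ-* zero    c f = sym (*-zeroʳ c)
  ∑-distribˡ-* (suc n) c f =
    trans (cong (c * f 0 +_) (∑-distribˡ-* n c (f ∘ suc))) (sym (*-distribˡ-+ c (f 0) _))

  ∑-comm : ∀ m n (f : ℕ → ℕ → ℕ) → ∑[ i < m ] ∑[ j < n ] f i j ≡ ∑[ j < n ] ∑[ i < m ] f i j
  ∑-comm zero    n f = sym (trans (∑-const n 0) (*-zeroʳ n))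
  ∑-comm (suc m) n f = trans (cong (∑< n (f 0) +_) (∑-comm m n (f ∘ suc)))
                             (sym (∑-distrib-+ n (f 0) (λ j → ∑[ i < m ] f (suc i) j)))

  ∑-blocks : ∀ m n (f : ℕ → ℕ) → ∑[ i < m * n ] f i ≡ ∑[ j < m ] ∑[ r < n ] f (j * n + r)
  ∑-blocks zero    n f = refl
  ∑-blocks (suc m) n f = begin
    ∑[ i < n + m * n ] f i                          ≡⟨ ∑-split n (m * n) f ⟩
    ∑[ r < n ] f r + ∑[ i < m * n ] f (n + i)       ≡⟨ cong (∑< n f +_) (∑-blocks m n (f ∘ (n +_))) ⟩
    ∑[ r < n ] f r + ∑[ j < m ] ∑[ r < n ] f (n + (j * n + r))
      ≡⟨ cong (∑< n f +_) (∑-cong m λ j _ → ∑-cong n λ r _ → cong f (sym (+-assoc n (j * n) r))) ⟩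
    ∑[ r < n ] f r + ∑[ j < m ] ∑[ r < n ] f (suc j * n + r) ∎
    where open ≡-Reasoning

  ∑-by-residue : ∀ m n (f : ℕ → ℕ) → ∑[ i < m * n ] f i ≡ ∑[ r < n ] ∑[ j < m ] f (r + j * n)
  ∑-by-residue m n f = trans (∑-blocks m n f) (trans (∑-comm m n (λ j r → f (j * n + r)))
    (∑-cong n λ r _ → ∑-cong m λ j _ → cong f (+-comm (j * n) r)))

  ∑-single : ∀ n j (f : ℕ → ℕ) → j < n → (∀ i → i < n → i ≢ j → f i ≡ 0) → ∑[ i < n ] f i ≡ f j
  ∑-single (suc n) zero    f _         others =
    trans (cong (f 0 +_) (∑-zero n λ i i<n → others (suc i) (s<s i<n) λ ())) (+-identityʳ (f 0))
  ∑-single (suc n) (suc j) f (s<s j<n) others =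
    trans (cong (_+ ∑[ i < n ] f (suc i)) (others 0 z<s λ ()))
          (∑-single n j (f ∘ suc) j<n λ i i<n i≢j → others (suc i) (s<s i<n) (i≢j ∘ suc-injective))

  ∑-restrict : ∀ {m n} {f g : ℕ → ℕ} → m ≤ n →
    (∀ i → i < m → f i ≡ g i) → (∀ i → m ≤ i → f i ≡ 0) → ∑[ i < n ] f i ≡ ∑[ i < m ] g i
  ∑-restrict {m} {n} {f} {g} m≤n f≡g f≡0 = begin
    ∑[ i < n ] f i                             ≡⟨ cong (λ l → ∑< l f) (m+[n∸m]≡n m≤n) ⟨
    ∑[ i < m + (n ∸ m) ] f i                   ≡⟨ ∑-split m (n ∸ m) f ⟩
    ∑[ i < m ] f i + ∑[ i < n ∸ m ] f (m + i)
      ≡⟨ cong₂ _+_ (∑-cong m f≡g) (∑-zero (n ∸ m) λ i _ → f≡0 (m + i) (m≤m+n m i)) ⟩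
    ∑[ i < m ] g i + 0                         ≡⟨ +-identityʳ _ ⟩
    ∑[ i < m ] g i                             ∎
    where open ≡-Reasoning

  ∑-≤-+ : ∀ n {B} {f g : ℕ → ℕ} → (∀ i → f i ≤ g i + B) → ∑[ i < n ] f i ≤ ∑[ i < n ] g i + n * B
  ∑-≤-+ n {B} {f} {g} f≤g+B = begin
    ∑[ i < n ] f i                  ≤⟨ ∑-mono-≤ n f≤g+B ⟩
    ∑[ i < n ] (g i + B)            ≡⟨ ∑-distrib-+ n g (λ _ → B) ⟩
    ∑[ i < n ] g i + ∑[ i < n ] B   ≡⟨ cong (∑[ i < n ] g i +_) (∑-const n B) ⟩
    ∑[ i < n ] g i + n * B          ∎
    where open ≤-Reasoning

  ∑-pairs-≥ : ∀ n (f : ℕ → ℕ) → (∀ i → 1 ≤ f i + f (suc i)) → n ≤ 2 * ∑[ i < n ] f i + 1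
  ∑-pairs-≥ zero          f pair≥1 = z≤n
  ∑-pairs-≥ (suc zero)    f pair≥1 = m≤n+m 1 _
  ∑-pairs-≥ (suc (suc n)) f pair≥1 = begin
    2 + n                          ≤⟨ +-monoʳ-≤ 2 (∑-pairs-≥ n (f ∘ suc ∘ suc) (pair≥1 ∘ suc ∘ suc)) ⟩
    2 + (2 * S + 1)                ≤⟨ +-monoˡ-≤ (2 * S + 1) (*-monoʳ-≤ 2 (pair≥1 0)) ⟩
    2 * (f 0 + f 1) + (2 * S + 1)  ≡⟨ regroup (f 0) (f 1) S ⟩
    2 * (f 0 + (f 1 + S)) + 1      ∎
    where
    open ≤-Reasoning
    S : ℕ
    S = ∑[ i < n ] f (suc (suc i))
    regroup : ∀ x y s → 2 * (x + y) + (2 * s + 1) ≡ 2 * (x + (y + s)) + 1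
    regroup = ℕ-Ring.solve-∀

  record WindowBalanced (L : ℕ) (f g : ℕ → ℕ) : Set where
    field
      window-sum : ∀ a → ∑[ i < L ] f (a + i) ≡ ∑[ i < L ] g (a + i)

  open WindowBalanced public

  WindowBalanced-sym : ∀ {L f g} → WindowBalanced L f g → WindowBalanced L g f
  WindowBalanced-sym balanced .window-sum a = sym (window-sum balanced a)

  -- Write n = q L + t: the q full windows contribute equally, the rest at most t B ≤ L B.
  module _ {L B : ℕ} {f g : ℕ → ℕ} (balanced : WindowBalanced L f g) (f≤B : ∀ i → f i ≤ B) where

    private
      ∑-≤-blocks : ∀ q t a → t ≤ L →
        ∑[ i < q * L + t ] f (a + i) ≤ ∑[ i < q * L + t ] g (a + i) + L * B
      ∑-≤-blocks zero t a t≤L = begin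
        ∑[ i < t ] f (a + i)          ≤⟨ ∑-mono-≤ t (f≤B ∘ (a +_)) ⟩
        ∑[ i < t ] B                  ≡⟨ ∑-const t B ⟩
        t * B                         ≤⟨ *-monoˡ-≤ B t≤L ⟩
        L * B                         ≤⟨ m≤n+m (L * B) _ ⟩
        ∑[ i < t ] g (a + i) + L * B  ∎
        where open ≤-Reasoning
      ∑-≤-blocks (suc q) t a t≤L = begin
        ∑[ i < suc q * L + t ] f (a + i)               ≡⟨ peel f ⟩
        ∑[ i < L ] f (a + i) + ∑[ i < n ] f (a + L + i) ≡⟨ cong (_+ _) (window-sum balanced a) ⟩
        ∑[ i < L ] g (a + i) + ∑[ i < n ] f (a + L + i)
          ≤⟨ +-monoʳ-≤ (∑[ i < L ] g (a + i)) (∑-≤-blocks q t (a + L) t≤L) ⟩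
        ∑[ i < L ] g (a + i) + (∑[ i < n ] g (a + L + i) + L * B)
          ≡⟨ +-assoc (∑[ i < L ] g (a + i)) _ (L * B) ⟨
        ∑[ i < L ] g (a + i) + ∑[ i < n ] g (a + L + i) + L * B ≡⟨ cong (_+ L * B) (peel g) ⟨
        ∑[ i < suc q * L + t ] g (a + i) + L * B       ∎
        where
        open ≤-Reasoning
        n : ℕ
        n = q * L + t
        peel : ∀ h → ∑[ i < suc q * L + t ] h (a + i) ≡ ∑[ i < L ] h (a + i) + ∑[ i < n ] h (a + L + i)
        peel h = begin-equality
          ∑[ i < suc q * L + t ] h (a + i)                ≡⟨ cong (λ m → ∑< m (h ∘ (a +_))) (+-assoc L (q * L) t) ⟩
          ∑[ i < L + n ] h (a + i)                        ≡⟨ ∑-split L n (h ∘ (a +_)) ⟩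
          ∑[ i < L ] h (a + i) + ∑[ i < n ] h (a + (L + i))
            ≡⟨ cong (∑< L (h ∘ (a +_)) +_) (∑-cong n λ i _ → cong h (sym (+-assoc a L i))) ⟩
          ∑[ i < L ] h (a + i) + ∑[ i < n ] h (a + L + i) ∎

    balanced⇒∑-≤ : .{{_ : NonZero L}} → ∀ n a → ∑[ i < n ] f (a + i) ≤ ∑[ i < n ] g (a + i) + L * B
    balanced⇒∑-≤ n a = subst (λ m → ∑[ i < m ] f (a + i) ≤ ∑[ i < m ] g (a + i) + L * B)
      (sym n≡[n/L]*L+n%L) (∑-≤-blocks (n / L) (n % L) a (<⇒≤ (m%n<n n L)))
      where
      n≡[n/L]*L+n%L : n ≡ n / L * L + n % L
      n≡[n/L]*L+n%L = trans (m≡m%n+[m/n]*n n L) (+-comm (n % L) _)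

  module _ {a ℓ} {A : Set a} {P : Pred A ℓ} (P? : Decidable P) where

    length-filter-++ : ∀ xs ys →
      length (filter P? (xs ++ ys)) ≡ length (filter P? xs) + length (filter P? ys)
    length-filter-++ xs ys = trans (cong length (filter-++ P? xs ys)) (length-++ (filter P? xs))

    length-filter-applyUpTo : ∀ (f : ℕ → A) n →
      length (filter P? (applyUpTo f n)) ≡ ∑[ i < n ] 𝟙 (P? (f i))
    length-filter-applyUpTo f zero = refl
    length-filter-applyUpTo f (suc n) with P? (f 0)
    ... | yes _ = cong suc (length-filter-applyUpTo (f ∘ suc) n)
    ... | no _  = length-filter-applyUpTo (f ∘ suc) n

    filter-filter : ∀ {ℓ′} {Q : Pred A ℓ′} (Q? : Decidable Q) xs →
      filter Q? (filter P? xs) ≡ filter (P? ∩? Q?) xs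
    filter-filter Q? [] = refl
    filter-filter Q? (x ∷ xs) with P? x
    ... | no _  = filter-filter Q? xs
    ... | yes _ with Q? x
    ...   | yes _ = cong (x ∷_) (filter-filter Q? xs)
    ...   | no _  = filter-filter Q? xs

  module _ {a b ℓ} {A : Set a} {B : Set b} {P : Pred (A × B) ℓ} (P? : Decidable P) where

    length-filter-cartesianProduct : ∀ (f : ℕ → A) (g : ℕ → B) m n →
      length (filter P? (cartesianProduct (applyUpTo f m) (applyUpTo g n)))
        ≡ ∑[ i < m ] ∑[ j < n ] 𝟙 (P? (f i , g j))
    length-filter-cartesianProduct f g zero    n = refl
    length-filter-cartesianProduct f g (suc m) n = begin
      length (filter P? (map (f 0 ,_) gs ++ cartesianProduct (applyUpTo (f ∘ suc) m) gs))
        ≡⟨ length-filter-++ P? (map (f 0 ,_) gs) _ ⟩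
      length (filter P? (map (f 0 ,_) gs)) + length (filter P? (cartesianProduct (applyUpTo (f ∘ suc) m) gs))
        ≡⟨ cong₂ _+_ (cong (length ∘ filter P?) (map-applyUpTo g (f 0 ,_) n))
                     (length-filter-cartesianProduct (f ∘ suc) g m n) ⟩
      length (filter P? (applyUpTo ((f 0 ,_) ∘ g) n)) + ∑[ i < m ] ∑[ j < n ] 𝟙 (P? (f (suc i) , g j))
        ≡⟨ cong (_+ _) (length-filter-applyUpTo P? ((f 0 ,_) ∘ g) n) ⟩
      ∑[ j < n ] 𝟙 (P? (f 0 , g j)) + ∑[ i < m ] ∑[ j < n ] 𝟙 (P? (f (suc i) , g j)) ∎
      where
      open ≡-Reasoning
      gs : List B
      gs = applyUpTo g n

module Congruences where

  open import Data.Nat using (ℕ; zero; suc; _+_; _*_; _^_; _∸_; _<_; NonZero; ≢-nonZero; >-nonZero; pred)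
  open import Data.Nat.Properties
  open import Data.Nat.Divisibility using (_∣_; divides; >⇒∤; ∣1⇒≡1; m∣m*n; ∣m⇒∣m*n)
  open import Data.Nat.Primality using (Prime; prime⇒irreducible; prime⇒nonZero; ¬prime[1]; euclidsLemma)
  open import Data.Nat.Coprimality using (Coprime; coprime-Bézout)
  open import Data.Nat.GCD using (module Bézout)
  import Data.Nat.Tactic.RingSolver as ℕ-Ring
  open import Data.Integer as ℤ using (ℤ; 0ℤ; 1ℤ)
  import Data.Integer.Properties as ℤ
  import Data.Integer.Divisibility.Signed as ℤ∣
  open import Data.Integer.Divisibility.Signed using () renaming (_∣_ to _∣ℤ_; _∣?_ to _∣ℤ?_)
  import Data.Integer.Coprimality as ℤCoprime
  open import Data.Integer.DivMod using (_%ℕ_; _/ℕ_; a≡a%ℕn+[a/ℕn]*n; n%ℕd<d)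
  import Data.Integer.Tactic.RingSolver as ℤ-Ring
  open import Data.Fin using (Fin; toℕ; fromℕ<)
  open import Data.Fin.Properties using (pigeonhole; toℕ<n; fromℕ<-injective)
  open import Data.Product using (∃; _×_; _,_)
  open import Data.Sum using (inj₁; inj₂)
  open import Data.Empty using (⊥-elim)
  open import Relation.Nullary using (¬_)
  open import Relation.Binary.PropositionalEquality
  open FiniteSums

  ∣∧<⇒≡0 : ∀ {p m} → p ∣ m → m < p → m ≡ 0
  ∣∧<⇒≡0 {m = zero}  _   _   = refl
  ∣∧<⇒≡0 {m = suc m} p∣m m<p = ⊥-elim (>⇒∤ m<p p∣m)

  module _ {i m n : ℤ} where

    ∣m-n∣n⇒∣m : i ∣ℤ m ℤ.- n → i ∣ℤ n → i ∣ℤ m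
    ∣m-n∣n⇒∣m i∣m-n i∣n = subst (i ∣ℤ_) (m-n+n≡m m n) (ℤ∣.∣m∣n⇒∣m+n i∣m-n i∣n)
      where
      m-n+n≡m : ∀ m n → m ℤ.- n ℤ.+ n ≡ m
      m-n+n≡m = ℤ-Ring.solve-∀

    ∣m-n∣m⇒∣n : i ∣ℤ m ℤ.- n → i ∣ℤ m → i ∣ℤ n
    ∣m-n∣m⇒∣n i∣m-n i∣m = subst (i ∣ℤ_) (m-[m-n]≡n m n) (ℤ∣.∣m∣n⇒∣m-n i∣m i∣m-n)
      where
      m-[m-n]≡n : ∀ m n → m ℤ.- (m ℤ.- n) ≡ n
      m-[m-n]≡n = ℤ-Ring.solve-∀

  ∣x-1⇒∣x^n-1 : ∀ {q} x → q ∣ℤ x ℤ.- 1ℤ → ∀ n → q ∣ℤ x ℤ.^ n ℤ.- 1ℤ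
  ∣x-1⇒∣x^n-1 x q∣x-1 zero    = ℤ∣.divides 0ℤ refl
  ∣x-1⇒∣x^n-1 x q∣x-1 (suc n) = subst (_ ∣ℤ_) (sym (xy-1≡x[y-1]+[x-1] x (x ℤ.^ n)))
    (ℤ∣.∣m∣n⇒∣m+n (ℤ∣.∣n⇒∣m*n x (∣x-1⇒∣x^n-1 x q∣x-1 n)) q∣x-1)
    where
    xy-1≡x[y-1]+[x-1] : ∀ x y → x ℤ.* y ℤ.- 1ℤ ≡ x ℤ.* (y ℤ.- 1ℤ) ℤ.+ (x ℤ.- 1ℤ)
    xy-1≡x[y-1]+[x-1] = ℤ-Ring.solve-∀

  d-shift : ∀ {q σ} → q ∣ℤ (ℤ.+ 2) ℤ.^ σ ℤ.- 1ℤ → q ∣ℤ ℤ.+ σ ℤ.+ 1ℤ →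
    ∀ k h j → q ∣ℤ d k (h + j * σ) ℤ.- (d k h ℤ.+ ℤ.+ j)
  d-shift {q} {σ} q∣2^σ-1 q∣σ+1 k h j = subst (q ∣ℤ_) (sym difference)
    (ℤ∣.∣m∣n⇒∣m-n (ℤ∣.∣n⇒∣m*n (2^ k ℤ.* 2^ h) (∣x-1⇒∣x^n-1 (2^ σ) q∣2^σ-1 j))
                  (ℤ∣.∣n⇒∣m*n (ℤ.+ j) q∣σ+1))
    where
    2^_ : ℕ → ℤ
    2^ n = (ℤ.+ 2) ℤ.^ n
    2^[h+jσ] : 2^ (h + j * σ) ≡ 2^ h ℤ.* (2^ σ) ℤ.^ j
    2^[h+jσ] = trans (ℤ.^-distribˡ-+-* (ℤ.+ 2) h (j * σ))
      (cong (2^ h ℤ.*_) (trans (cong 2^_ (*-comm j σ)) (sym (ℤ.^-*-assoc (ℤ.+ 2) σ j))))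
    h+jσ : ℤ.+ (h + j * σ) ≡ ℤ.+ h ℤ.+ ℤ.+ j ℤ.* ℤ.+ σ
    h+jσ = trans (ℤ.pos-+ h (j * σ)) (cong (λ x → ℤ.+ h ℤ.+ x) (ℤ.pos-* j σ))
    regroup : ∀ A H Y h j s →
      A ℤ.* (H ℤ.* Y ℤ.- 1ℤ) ℤ.- (h ℤ.+ j ℤ.* s) ℤ.- (A ℤ.* (H ℤ.- 1ℤ) ℤ.- h ℤ.+ j)
        ≡ A ℤ.* H ℤ.* (Y ℤ.- 1ℤ) ℤ.- j ℤ.* (s ℤ.+ 1ℤ)
    regroup = ℤ-Ring.solve-∀
    difference : d k (h + j * σ) ℤ.- (d k h ℤ.+ ℤ.+ j)
               ≡ 2^ k ℤ.* 2^ h ℤ.* ((2^ σ) ℤ.^ j ℤ.- 1ℤ) ℤ.- ℤ.+ j ℤ.* (ℤ.+ σ ℤ.+ 1ℤ)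
    difference = trans (cong₂ (λ x y → 2^ k ℤ.* (x ℤ.- 1ℤ) ℤ.- y ℤ.- (d k h ℤ.+ ℤ.+ j)) 2^[h+jσ] h+jσ)
                       (regroup (2^ k) (2^ h) ((2^ σ) ℤ.^ j) (ℤ.+ h) (ℤ.+ j) (ℤ.+ σ))

  module _ (p : ℕ) .{{_ : NonZero p}} (A : ℤ) where

    ∣+-unique : ∀ {i j} → i < p → j < p → ℤ.+ p ∣ℤ A ℤ.+ ℤ.+ i → ℤ.+ p ∣ℤ A ℤ.+ ℤ.+ j → i ≡ j
    ∣+-unique {i} {j} i<p j<p p∣A+i p∣A+j = sym (ℤ.+-injective (ℤ.i-j≡0⇒i≡j (ℤ.+ j) (ℤ.+ i) j-i≡0))
      where
      A+j-[A+i]≡j-i : ∀ A i j → A ℤ.+ j ℤ.- (A ℤ.+ i) ≡ j ℤ.- i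
      A+j-[A+i]≡j-i = ℤ-Ring.solve-∀
      p∣∣j⊖i∣ : p ∣ ℤ.∣ j ℤ.⊖ i ∣
      p∣∣j⊖i∣ = ℤ∣.∣⇒∣ᵤ (subst (ℤ.+ p ∣ℤ_) (trans (A+j-[A+i]≡j-i A _ _) (ℤ.m-n≡m⊖n j i))
                                (ℤ∣.∣m∣n⇒∣m-n p∣A+j p∣A+i))
      j-i≡0 : ℤ.+ j ℤ.- ℤ.+ i ≡ 0ℤ
      j-i≡0 = trans (ℤ.m-n≡m⊖n j i)
        (ℤ.∣i∣≡0⇒i≡0 (∣∧<⇒≡0 p∣∣j⊖i∣ (≤-<-trans (ℤ.∣m⊝n∣≤m⊔n j i) (⊔-lub j<p i<p))))

    ∣+-witness : ℤ.+ p ∣ℤ A ℤ.+ ℤ.+ ((ℤ.- A) %ℕ p)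
    ∣+-witness = ℤ∣.divides (ℤ.- q) (cancel A (ℤ.+ ((ℤ.- A) %ℕ p)) q (ℤ.+ p) (a≡a%ℕn+[a/ℕn]*n (ℤ.- A) p))
      where
      q : ℤ
      q = (ℤ.- A) /ℕ p
      negate : ∀ r q P → ℤ.- (r ℤ.+ q ℤ.* P) ℤ.+ r ≡ ℤ.- q ℤ.* P
      negate = ℤ-Ring.solve-∀
      cancel : ∀ A r q P → ℤ.- A ≡ r ℤ.+ q ℤ.* P → A ℤ.+ r ≡ ℤ.- q ℤ.* P
      cancel A r q P -A≡r+qP =
        trans (cong (ℤ._+ r) (trans (sym (ℤ.neg-involutive A)) (cong ℤ.-_ -A≡r+qP))) (negate r q P)

    ∑-𝟙-∣+ : ∑[ j < p ] 𝟙 (ℤ.+ p ∣ℤ? A ℤ.+ ℤ.+ j) ≡ 1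
    ∑-𝟙-∣+ = trans (∑-single p j₀ _ j₀<p λ j j<p j≢j₀ →
                      𝟙-no (λ p∣A+j → j≢j₀ (∣+-unique j<p j₀<p p∣A+j ∣+-witness)) _)
                   (𝟙-yes ∣+-witness _)
      where
      j₀ : ℕ
      j₀ = (ℤ.- A) %ℕ p
      j₀<p : j₀ < p
      j₀<p = n%ℕd<d (ℤ.- A) p

  pos-^ : ∀ a n → ℤ.+ (a ^ n) ≡ (ℤ.+ a) ℤ.^ n
  pos-^ a zero    = refl
  pos-^ a (suc n) = trans (ℤ.pos-* a (a ^ n)) (cong (ℤ.+ a ℤ.*_) (pos-^ a n))

  prime∧∤⇒coprime : ∀ {p n} → Prime p → ¬ p ∣ n → Coprime p n
  prime∧∤⇒coprime pp p∤n (d∣p , d∣n) with prime⇒irreducible pp d∣p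
  ... | inj₁ d≡1  = d≡1
  ... | inj₂ refl = ⊥-elim (p∤n d∣n)

  prime∧∤⇒∤^ : ∀ {p a} → Prime p → ¬ p ∣ a → ∀ n → ¬ p ∣ a ^ n
  prime∧∤⇒∤^ pp p∤a zero    p∣1 = ¬prime[1] (subst Prime (∣1⇒≡1 p∣1) pp)
  prime∧∤⇒∤^ {a = a} pp p∤a (suc n) p∣aⁿ⁺¹ with euclidsLemma a (a ^ n) pp p∣aⁿ⁺¹
  ... | inj₁ p∣a  = p∤a p∣a
  ... | inj₂ p∣aⁿ = prime∧∤⇒∤^ pp p∤a n p∣aⁿ

  -- The residues of aⁱ modulo p (i < p) are nonzero, so by pigeonhole two of them coincide.
  module _ {p a : ℕ} (pp : Prime p) (p∤a : ¬ p ∣ a) where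

    private
      instance
        p-nonZero : NonZero p
        p-nonZero = prime⇒nonZero pp

      x : ℤ
      x = ℤ.+ a

      ∣xⁿ∣≡aⁿ : ∀ n → ℤ.∣ x ℤ.^ n ∣ ≡ a ^ n
      ∣xⁿ∣≡aⁿ n = cong ℤ.∣_∣ (sym (pos-^ a n))

      residue : ℕ → ℕ
      residue n = (x ℤ.^ n) %ℕ p

      quotient : ℕ → ℤ
      quotient n = (x ℤ.^ n) /ℕ p

      division : ∀ n → x ℤ.^ n ≡ ℤ.+ residue n ℤ.+ quotient n ℤ.* ℤ.+ p
      division n = a≡a%ℕn+[a/ℕn]*n (x ℤ.^ n) p

      residue-nonZero : ∀ n → NonZero (residue n)
      residue-nonZero n = ≢-nonZero λ rₙ≡0 → prime∧∤⇒∤^ pp p∤a n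
        (subst (p ∣_) (∣xⁿ∣≡aⁿ n) (ℤ∣.∣⇒∣ᵤ (ℤ∣.divides (quotient n) (begin
          x ℤ.^ n                                       ≡⟨ division n ⟩
          ℤ.+ residue n ℤ.+ quotient n ℤ.* ℤ.+ p        ≡⟨ cong (λ r → ℤ.+ r ℤ.+ quotient n ℤ.* ℤ.+ p) rₙ≡0 ⟩
          0ℤ ℤ.+ quotient n ℤ.* ℤ.+ p                   ≡⟨ ℤ.+-identityˡ _ ⟩
          quotient n ℤ.* ℤ.+ p                          ∎))))
        where open ≡-Reasoning

      equal-residues⇒∣xⁿ-1 : ∀ m n → residue m ≡ residue (m + n) → ℤ.+ p ∣ℤ x ℤ.^ n ℤ.- 1ℤ
      equal-residues⇒∣xⁿ-1 m n rₘ≡rₘ₊ₙ =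
        ℤ∣.∣ᵤ⇒∣ (ℤCoprime.coprime-divisor (ℤ.+ p) (x ℤ.^ m) _ p⊥xᵐ (ℤ∣.∣⇒∣ᵤ p∣xᵐ[xⁿ-1]))
        where
        open ≡-Reasoning
        p⊥xᵐ : Coprime p ℤ.∣ x ℤ.^ m ∣
        p⊥xᵐ = subst (Coprime p) (sym (∣xⁿ∣≡aⁿ m)) (prime∧∤⇒coprime pp (prime∧∤⇒∤^ pp p∤a m))
        factor : ∀ y z → y ℤ.* (z ℤ.- 1ℤ) ≡ y ℤ.* z ℤ.- y
        factor = ℤ-Ring.solve-∀
        cancel : ∀ r s t q → r ℤ.+ s ℤ.* q ℤ.- (r ℤ.+ t ℤ.* q) ≡ (s ℤ.- t) ℤ.* q
        cancel = ℤ-Ring.solve-∀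
        r q q′ : ℤ
        r = ℤ.+ residue m
        q = quotient (m + n)
        q′ = quotient m
        p∣xᵐ[xⁿ-1] : ℤ.+ p ∣ℤ x ℤ.^ m ℤ.* (x ℤ.^ n ℤ.- 1ℤ)
        p∣xᵐ[xⁿ-1] = ℤ∣.divides (q ℤ.- q′) (begin
          x ℤ.^ m ℤ.* (x ℤ.^ n ℤ.- 1ℤ)                          ≡⟨ factor (x ℤ.^ m) (x ℤ.^ n) ⟩
          x ℤ.^ m ℤ.* x ℤ.^ n ℤ.- x ℤ.^ m                      ≡⟨ cong (ℤ._- x ℤ.^ m) (ℤ.^-distribˡ-+-* x m n) ⟨
          x ℤ.^ (m + n) ℤ.- x ℤ.^ m                             ≡⟨ cong₂ ℤ._-_ (division (m + n)) (division m) ⟩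
          ℤ.+ residue (m + n) ℤ.+ q ℤ.* ℤ.+ p ℤ.- (r ℤ.+ q′ ℤ.* ℤ.+ p)
            ≡⟨ cong (λ s → ℤ.+ s ℤ.+ q ℤ.* ℤ.+ p ℤ.- (r ℤ.+ q′ ℤ.* ℤ.+ p)) (sym rₘ≡rₘ₊ₙ) ⟩
          r ℤ.+ q ℤ.* ℤ.+ p ℤ.- (r ℤ.+ q′ ℤ.* ℤ.+ p)            ≡⟨ cancel r q q′ (ℤ.+ p) ⟩
          (q ℤ.- q′) ℤ.* ℤ.+ p                                  ∎)

      pred-residue : Fin p → Fin (pred p)
      pred-residue i = fromℕ< (pred-mono-< {{residue-nonZero (toℕ i)}} (n%ℕd<d (x ℤ.^ toℕ i) p))

    ∃-period : ∃ λ T → 0 < T × T < p × ℤ.+ p ∣ℤ (ℤ.+ a) ℤ.^ T ℤ.- 1ℤ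
    ∃-period with pigeonhole (subst (pred p <_) (suc-pred p) (n<1+n (pred p))) pred-residue
    ... | i , j , i<j , eq =
      toℕ j ∸ toℕ i , m<n⇒0<n∸m i<j , ≤-<-trans (m∸n≤m (toℕ j) (toℕ i)) (toℕ<n j) ,
      equal-residues⇒∣xⁿ-1 (toℕ i) (toℕ j ∸ toℕ i)
        (trans (pred-injective {{residue-nonZero (toℕ i)}} {{residue-nonZero (toℕ j)}}
                 (fromℕ<-injective _ _ _ _ eq))
               (cong residue (sym (m+[n∸m]≡n (<⇒≤ i<j)))))

  ∃-negInverse : ∀ {p m} .{{_ : NonZero p}} → Coprime p m → ∃ λ w → p ∣ m * w + 1
  ∃-negInverse {suc p′} {m} coprime with coprime-Bézout coprime
  ... | Bézout.+- x y 1+ym≡xp = y , divides x (trans (swap m y) 1+ym≡xp)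
    where
    swap : ∀ m y → m * y + 1 ≡ 1 + y * m
    swap = ℕ-Ring.solve-∀
  ... | Bézout.-+ x y 1+xp≡ym = y * p′ , divides (1 + x * p′) (begin
    m * (y * p′) + 1           ≡⟨ reassociate m y p′ ⟩
    y * m * p′ + 1             ≡⟨ cong (λ z → z * p′ + 1) 1+xp≡ym ⟨
    (1 + x * suc p′) * p′ + 1  ≡⟨ refactor x p′ ⟩
    (1 + x * p′) * suc p′      ∎)
    where
    open ≡-Reasoning
    reassociate : ∀ m y p′ → m * (y * p′) + 1 ≡ y * m * p′ + 1
    reassociate = ℕ-Ring.solve-∀
    refactor : ∀ x p′ → (1 + x * suc p′) * p′ + 1 ≡ (1 + x * p′) * suc p′
    refactor = ℕ-Ring.solve-∀

  -- Shifting h by σ preserves its parity and, by d-shift, adds 1 to d(k, h) modulo p.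
  record UnitShift (p σ : ℕ) : Set where
    field
      σ-even  : 2 ∣ σ
      p∣2^σ-1 : ℤ.+ p ∣ℤ (ℤ.+ 2) ℤ.^ σ ℤ.- 1ℤ
      p∣σ+1   : p ∣ σ + 1

  unitShift-nonZero : ∀ {p σ} → 1 < p → UnitShift p σ → NonZero σ
  unitShift-nonZero {σ = zero}  1<p shift = ⊥-elim (<⇒≢ 1<p (sym (∣1⇒≡1 (UnitShift.p∣σ+1 shift))))
  unitShift-nonZero {σ = suc _} _   _     = _

  module _ {p : ℕ} (pp : Prime p) (2<p : 2 < p) where

    private
      instance
        p-nonZero : NonZero p
        p-nonZero = prime⇒nonZero pp

    period⇒unitShift : ∀ {T} → 0 < T → T < p → ℤ.+ p ∣ℤ (ℤ.+ 2) ℤ.^ T ℤ.- 1ℤ → ∃ (UnitShift p)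
    period⇒unitShift {T} 0<T T<p p∣2ᵀ-1 =
      let w , p∣2Tw+1 = ∃-negInverse (prime∧∤⇒coprime pp p∤2T) in
      2 * T * w , record
        { σ-even  = ∣m⇒∣m*n w (m∣m*n T)
        ; p∣2^σ-1 = subst (λ n → ℤ.+ p ∣ℤ (ℤ.+ 2) ℤ.^ n ℤ.- 1ℤ) (T[2w]≡2Tw T w)
                      (subst (λ z → ℤ.+ p ∣ℤ z ℤ.- 1ℤ) (ℤ.^-*-assoc (ℤ.+ 2) T (2 * w))
                        (∣x-1⇒∣x^n-1 ((ℤ.+ 2) ℤ.^ T) p∣2ᵀ-1 (2 * w)))
        ; p∣σ+1   = p∣2Tw+1
        }
      where
      p∤2T : ¬ p ∣ 2 * T
      p∤2T p∣2T with euclidsLemma 2 T pp p∣2T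
      ... | inj₁ p∣2 = >⇒∤ 2<p p∣2
      ... | inj₂ p∣T = >⇒∤ {{>-nonZero 0<T}} T<p p∣T
      T[2w]≡2Tw : ∀ T w → T * (2 * w) ≡ 2 * T * w
      T[2w]≡2Tw = ℕ-Ring.solve-∀

    ∃-unitShift : ∃ (UnitShift p)
    ∃-unitShift =
      let _ , 0<T , T<p , p∣2ᵀ-1 = ∃-period pp (>⇒∤ 2<p) in period⇒unitShift 0<T T<p p∣2ᵀ-1

module Counting where

  open import Data.Nat
    using (ℕ; zero; suc; _+_; _*_; _∸_; _≤_; _<_; z≤n; s≤s; z<s; NonZero; ≢-nonZero; >-nonZero; >-nonZero⁻¹)
  open import Data.Nat.Properties
  open import Data.Nat.Divisibility using (_∣_; _∣?_; divides; ∣n⇒∣m*n; ∣m∣n⇒∣m+n; ∣m+n∣m⇒∣n)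
  import Data.Nat.Tactic.RingSolver as ℕ-Ring
  open import Data.Integer as ℤ using (_⊖_)
  import Data.Integer.Properties as ℤ
  import Data.Integer.Divisibility.Signed as ℤ∣
  open import Data.Integer.Divisibility.Signed using () renaming (_∣_ to _∣ℤ_; _∣?_ to _∣ℤ?_)
  open import Data.Rational as ℚ using (ℚ; toℚᵘ)
  open import Data.Rational.Properties
    using (toℚᵘ-homo-∣-∣; toℚᵘ-homo-+; toℚᵘ-homo‿-; toℚᵘ-homo-*; toℚᵘ-fromℚᵘ; toℚᵘ-cancel-≤)
  import Data.Rational.Unnormalised as ℚᵘ
  import Data.Rational.Unnormalised.Properties as ℚᵘ
  open import Data.Product using (_,_)
  open import Data.Sum using (_⊎_; inj₁; inj₂)
  open import Data.List using (filter; length; upTo; cartesianProduct)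
  open import Relation.Unary.Properties using (_∩?_)
  open import Relation.Nullary using (_×-dec_)
  open import Function using (id; _∘_)
  open import Relation.Binary.PropositionalEquality
  open FiniteSums
  open Congruences

  χ-even : ℕ → ℕ
  χ-even h = 𝟙 (2 ∣? h)

  χ-even-∣d : ℕ → ℕ → ℕ → ℕ
  χ-even-∣d p k h = χ-even h * 𝟙 (ℤ.+ p ∣ℤ? d k h)

  χ-even-periodic : ∀ {σ} → 2 ∣ σ → ∀ h j → χ-even (h + j * σ) ≡ χ-even h
  χ-even-periodic {σ} 2∣σ h j = 𝟙-cong
    (λ 2∣h+jσ → ∣m+n∣m⇒∣n (subst (2 ∣_) (+-comm h (j * σ)) 2∣h+jσ) (∣n⇒∣m*n j 2∣σ))
    (λ 2∣h → ∣m∣n⇒∣m+n 2∣h (∣n⇒∣m*n j 2∣σ)) _ _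

  χ-even-∣d≤χ-even : ∀ p k h → χ-even-∣d p k h ≤ χ-even h
  χ-even-∣d≤χ-even p k h =
    ≤-trans (*-monoʳ-≤ (χ-even h) (𝟙≤1 (ℤ.+ p ∣ℤ? d k h))) (≤-reflexive (*-identityʳ _))

  even⊎odd : ∀ h → 2 ∣ h ⊎ 2 ∣ suc h
  even⊎odd zero    = inj₁ (divides 0 refl)
  even⊎odd (suc h) with even⊎odd h
  ... | inj₁ 2∣h   = inj₂ (∣m∣n⇒∣m+n (divides 1 refl) 2∣h)
  ... | inj₂ 2∣1+h = inj₁ 2∣1+h

  χ-even-pair≥1 : ∀ h → 1 ≤ χ-even h + χ-even (suc h)
  χ-even-pair≥1 h with even⊎odd h
  ... | inj₁ 2∣h   = ≤-trans (≤-reflexive (sym (𝟙-yes 2∣h (2 ∣? h)))) (m≤m+n _ _)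
  ... | inj₂ 2∣1+h = ≤-trans (≤-reflexive (sym (𝟙-yes 2∣1+h (2 ∣? suc h)))) (m≤n+m _ _)

  module _ {p σ} .{{_ : NonZero p}} (shift : UnitShift p σ) (k : ℕ) where

    open UnitShift shift

    ∑-χ-even-block : ∀ h → ∑[ j < p ] χ-even (h + j * σ) ≡ p * χ-even h
    ∑-χ-even-block h = trans (∑-cong p λ j _ → χ-even-periodic σ-even h j) (∑-const p (χ-even h))

    ∑-χ-even-∣d-block : ∀ h → ∑[ j < p ] χ-even-∣d p k (h + j * σ) ≡ χ-even h
    ∑-χ-even-∣d-block h = begin
      ∑[ j < p ] χ-even-∣d p k (h + j * σ)
        ≡⟨ ∑-cong p (λ j _ → cong₂ _*_ (χ-even-periodic σ-even h j) (shifted j)) ⟩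
      ∑[ j < p ] (χ-even h * 𝟙 (ℤ.+ p ∣ℤ? d k h ℤ.+ ℤ.+ j))  ≡⟨ ∑-distribˡ-* p (χ-even h) _ ⟩
      χ-even h * ∑[ j < p ] 𝟙 (ℤ.+ p ∣ℤ? d k h ℤ.+ ℤ.+ j)    ≡⟨ cong (χ-even h *_) (∑-𝟙-∣+ p (d k h)) ⟩
      χ-even h * 1                                             ≡⟨ *-identityʳ (χ-even h) ⟩
      χ-even h                                                 ∎
      where
      open ≡-Reasoning
      shifted : ∀ j → 𝟙 (ℤ.+ p ∣ℤ? d k (h + j * σ)) ≡ 𝟙 (ℤ.+ p ∣ℤ? d k h ℤ.+ ℤ.+ j)
      shifted j = 𝟙-cong (∣m-n∣m⇒∣n p∣difference) (∣m-n∣n⇒∣m p∣difference) _ _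
        where
        p∣difference : ℤ.+ p ∣ℤ d k (h + j * σ) ℤ.- (d k h ℤ.+ ℤ.+ j)
        p∣difference = d-shift p∣2^σ-1 (ℤ∣.∣ᵤ⇒∣ p∣σ+1) k h j

    balanced : WindowBalanced (p * σ) (λ h → p * χ-even-∣d p k h) χ-even
    balanced .window-sum a = begin
      ∑[ i < p * σ ] (p * χ-even-∣d p k (a + i))              ≡⟨ ∑-distribˡ-* (p * σ) p _ ⟩
      p * ∑[ i < p * σ ] χ-even-∣d p k (a + i)                ≡⟨ cong (p *_) (by-residue (χ-even-∣d p k)) ⟩
      p * ∑[ r < σ ] ∑[ j < p ] χ-even-∣d p k (a + r + j * σ)
        ≡⟨ cong (p *_) (∑-cong σ λ r _ → ∑-χ-even-∣d-block (a + r)) ⟩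
      p * ∑[ r < σ ] χ-even (a + r)                           ≡⟨ ∑-distribˡ-* σ p _ ⟨
      ∑[ r < σ ] (p * χ-even (a + r))                         ≡⟨ ∑-cong σ (λ r _ → ∑-χ-even-block (a + r)) ⟨
      ∑[ r < σ ] ∑[ j < p ] χ-even (a + r + j * σ)            ≡⟨ by-residue χ-even ⟨
      ∑[ i < p * σ ] χ-even (a + i)                           ∎
      where
      open ≡-Reasoning
      by-residue : ∀ f → ∑[ i < p * σ ] f (a + i) ≡ ∑[ r < σ ] ∑[ j < p ] f (a + r + j * σ)
      by-residue f = trans (∑-by-residue p σ (f ∘ (a +_)))
                           (∑-cong σ λ r _ → ∑-cong p λ j _ → cong f (sym (+-assoc a r (j * σ))))

    module _ .{{_ : NonZero σ}} where

      private
        instance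
          pσ-nonZero : NonZero (p * σ)
          pσ-nonZero = m*n≢0 p σ

        p*χ-even-∣d≤p : ∀ h → p * χ-even-∣d p k h ≤ p
        p*χ-even-∣d≤p h = ≤-trans (*-monoʳ-≤ p (≤-trans (χ-even-∣d≤χ-even p k h) (𝟙≤1 (2 ∣? h))))
                                  (≤-reflexive (*-identityʳ p))

        χ-even≤p : ∀ h → χ-even h ≤ p
        χ-even≤p h = ≤-trans (𝟙≤1 (2 ∣? h)) (>-nonZero⁻¹ p)

      p*∑-χ-even-∣d≤ : ∀ n a →
        p * ∑[ i < n ] χ-even-∣d p k (a + i) ≤ ∑[ i < n ] χ-even (a + i) + p * σ * p
      p*∑-χ-even-∣d≤ n a = subst (_≤ ∑[ i < n ] χ-even (a + i) + p * σ * p) (∑-distribˡ-* n p _)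
        (balanced⇒∑-≤ balanced p*χ-even-∣d≤p n a)

      ∑-χ-even≤ : ∀ n a →
        ∑[ i < n ] χ-even (a + i) ≤ p * ∑[ i < n ] χ-even-∣d p k (a + i) + p * σ * p
      ∑-χ-even≤ n a = subst (λ z → ∑[ i < n ] χ-even (a + i) ≤ z + p * σ * p) (∑-distribˡ-* n p _)
        (balanced⇒∑-≤ (WindowBalanced-sym balanced) χ-even≤p n a)

  ∸-swap-≤ : ∀ {m n o} → n ≤ o → m ≤ o ∸ n → n ≤ o ∸ m
  ∸-swap-≤ {m} {n} {o} n≤o m≤o∸n =
    m+n≤o⇒m≤o∸n n (subst (_≤ o) (+-comm m n) (m≤o∸n⇒m+n≤o m n≤o m≤o∸n))

  module _ {K k : ℕ} where

    𝟙-InI-inside : ∀ {i} → k < K → i < K ∸ suc k → 𝟙 (InI? K (suc k , suc i)) ≡ χ-even (suc i)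
    𝟙-InI-inside k<K i<K∸[1+k] = 𝟙-cong (λ (_ , _ , 2∣h , _) → 2∣h)
      (λ 2∣h → s≤s z≤n , ≤-trans i<K∸[1+k] (∸-monoʳ-≤ K (s≤s z≤n)) , 2∣h , s≤s z≤n ,
               ∸-swap-≤ k<K i<K∸[1+k])
      _ _

    𝟙-InI-outside : ∀ {i} → K ∸ suc k ≤ i → 𝟙 (InI? K (suc k , suc i)) ≡ 0
    𝟙-InI-outside {i} K∸[1+k]≤i = 𝟙-no
      (λ (_ , h≤K∸1 , _ , _ , k₂≤K∸h) →
         <⇒≱ {i} (∸-swap-≤ (≤-trans h≤K∸1 (m∸n≤m K 1)) k₂≤K∸h) K∸[1+k]≤i)
      _

  𝟙-InI-k₂≡0 : ∀ K h → 𝟙 (InI? K (0 , h)) ≡ 0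
  𝟙-InI-k₂≡0 K h = 𝟙-no (λ { (_ , _ , _ , () , _) }) _

  -- Row k of I_K: k₂ = k + 1 and the even h = i + 1 with i < K ∸ (k + 1).
  #IK-row : ℕ → ℕ → ℕ
  #IK-row K k = ∑[ i < K ∸ suc k ] χ-even (suc i)

  #divSet-row : ℕ → ℕ → ℕ → ℕ
  #divSet-row p K k = ∑[ i < K ∸ suc k ] χ-even-∣d p (suc k) (suc i)

  #IK : ℕ → ℕ
  #IK K = ∑[ k < K ] #IK-row K k

  #divSet : ℕ → ℕ → ℕ
  #divSet p K = ∑[ k < K ] #divSet-row p K k

  -- The column h = 0 vanishes by evaluation of InI? (its first test is 1 ≤? 0).
  ∑-IK : ∀ K (c : ℕ → ℕ → ℕ) →
    ∑[ k < suc K ] ∑[ h < suc K ] (𝟙 (InI? K (k , h)) * c k h)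
      ≡ ∑[ k < K ] ∑[ i < K ∸ suc k ] (χ-even (suc i) * c (suc k) (suc i))
  ∑-IK K c = cong₂ _+_ (∑-zero (suc K) λ h _ → cong (_* c 0 h) (𝟙-InI-k₂≡0 K h))
    (∑-cong K λ k k<K → ∑-restrict (m∸n≤m K (suc k))
      (λ i i<K∸[1+k] → cong (_* c (suc k) (suc i)) (𝟙-InI-inside k<K i<K∸[1+k]))
      (λ i K∸[1+k]≤i → cong (_* c (suc k) (suc i)) (𝟙-InI-outside {K} K∸[1+k]≤i)))

  length-IK : ∀ K → length (IK K) ≡ #IK K
  length-IK K = begin
    length (IK K)
      ≡⟨ length-filter-cartesianProduct (InI? K) id id (suc K) (suc K) ⟩
    ∑[ k < suc K ] ∑[ h < suc K ] 𝟙 (InI? K (k , h))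
      ≡⟨ ∑-cong (suc K) (λ k _ → ∑-cong (suc K) λ h _ → *-identityʳ (𝟙 (InI? K (k , h)))) ⟨
    ∑[ k < suc K ] ∑[ h < suc K ] (𝟙 (InI? K (k , h)) * 1)
      ≡⟨ ∑-IK K (λ _ _ → 1) ⟩
    ∑[ k < K ] ∑[ i < K ∸ suc k ] (χ-even (suc i) * 1)
      ≡⟨ ∑-cong K (λ k _ → ∑-cong (K ∸ suc k) λ i _ → *-identityʳ (χ-even (suc i))) ⟩
    #IK K ∎
    where open ≡-Reasoning

  length-divSet : ∀ p K → length (divSet p K) ≡ #divSet p K
  length-divSet p K = begin
    length (divSet p K)
      ≡⟨ cong length (filter-filter (InI? K) _ (cartesianProduct (upTo (suc K)) (upTo (suc K)))) ⟩
    length (filter (InI? K ∩? _) (cartesianProduct (upTo (suc K)) (upTo (suc K))))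
      ≡⟨ length-filter-cartesianProduct (InI? K ∩? _) id id (suc K) (suc K) ⟩
    ∑[ k < suc K ] ∑[ h < suc K ] 𝟙 (InI? K (k , h) ×-dec ℤ.+ p ∣ℤ? d k h)
      ≡⟨ ∑-cong (suc K) (λ k _ → ∑-cong (suc K) λ h _ → 𝟙-×-dec (InI? K (k , h)) (ℤ.+ p ∣ℤ? d k h)) ⟩
    ∑[ k < suc K ] ∑[ h < suc K ] (𝟙 (InI? K (k , h)) * 𝟙 (ℤ.+ p ∣ℤ? d k h))
      ≡⟨ ∑-IK K (λ k h → 𝟙 (ℤ.+ p ∣ℤ? d k h)) ⟩
    #divSet p K ∎
    where open ≡-Reasoning

  2*∑[K∸1+k]+K≡K*K : ∀ K → 2 * ∑[ k < K ] (K ∸ suc k) + K ≡ K * K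
  2*∑[K∸1+k]+K≡K*K zero    = refl
  2*∑[K∸1+k]+K≡K*K (suc K) = begin
    2 * (K + Q) + suc K    ≡⟨ regroup K Q ⟩
    2 * Q + K + 2 * K + 1  ≡⟨ cong (λ x → x + 2 * K + 1) (2*∑[K∸1+k]+K≡K*K K) ⟩
    K * K + 2 * K + 1      ≡⟨ square K ⟩
    suc K * suc K          ∎
    where
    open ≡-Reasoning
    Q : ℕ
    Q = ∑[ k < K ] (K ∸ suc k)
    regroup : ∀ K Q → 2 * (K + Q) + suc K ≡ 2 * Q + K + 2 * K + 1
    regroup = ℕ-Ring.solve-∀
    square : ∀ K → K * K + 2 * K + 1 ≡ suc K * suc K
    square = ℕ-Ring.solve-∀

  K*K≤4*#IK+3*K : ∀ K → K * K ≤ 4 * #IK K + 3 * K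
  K*K≤4*#IK+3*K K = begin
    K * K                                           ≡⟨ 2*∑[K∸1+k]+K≡K*K K ⟨
    2 * ∑[ k < K ] (K ∸ suc k) + K                  ≤⟨ +-monoˡ-≤ K (*-monoʳ-≤ 2 (∑-≤-+ K rows)) ⟩
    2 * (∑[ k < K ] (2 * #IK-row K k) + K * 1) + K
      ≡⟨ cong (λ x → 2 * (x + K * 1) + K) (∑-distribˡ-* K 2 (#IK-row K)) ⟩
    2 * (2 * #IK K + K * 1) + K                     ≡⟨ regroup K (#IK K) ⟩
    4 * #IK K + 3 * K                               ∎
    where
    open ≤-Reasoning
    rows : ∀ k → K ∸ suc k ≤ 2 * #IK-row K k + 1
    rows k = ∑-pairs-≥ (K ∸ suc k) (χ-even ∘ suc) (χ-even-pair≥1 ∘ suc)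
    regroup : ∀ K N → 2 * (2 * N + K * 1) + K ≡ 4 * N + 3 * K
    regroup = ℕ-Ring.solve-∀

  K*K≤8*#IK : ∀ K → 6 ≤ K → K * K ≤ 8 * #IK K
  K*K≤8*#IK K 6≤K = +-cancelʳ-≤ (K * K) (K * K) (8 * #IK K) (begin
    K * K + K * K                              ≤⟨ +-mono-≤ (K*K≤4*#IK+3*K K) (K*K≤4*#IK+3*K K) ⟩
    (4 * #IK K + 3 * K) + (4 * #IK K + 3 * K)  ≡⟨ regroup (#IK K) K ⟩
    8 * #IK K + 6 * K                          ≤⟨ +-monoʳ-≤ (8 * #IK K) (*-monoˡ-≤ K 6≤K) ⟩
    8 * #IK K + K * K                          ∎)
    where
    open ≤-Reasoning
    regroup : ∀ N K → (4 * N + 3 * K) + (4 * N + 3 * K) ≡ 8 * N + 6 * K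
    regroup = ℕ-Ring.solve-∀

  ∣m⊖n∣≤ : ∀ {m n e} → m ≤ n + e → n ≤ m + e → ℤ.∣ m ⊖ n ∣ ≤ e
  ∣m⊖n∣≤ {m} {n} {e} m≤n+e n≤m+e with ≤-total m n
  ... | inj₁ m≤n = subst (_≤ e) (sym (ℤ.∣⊖∣-≤ m≤n)) (m≤n+o⇒m∸n≤o n m n≤m+e)
  ... | inj₂ n≤m = subst (_≤ e) (sym (trans (ℤ.∣m⊖n∣≡∣n⊖m∣ m n) (ℤ.∣⊖∣-≤ n≤m))) (m≤n+o⇒m∸n≤o m n m≤n+e)

  -- Proved in ℚᵘ, where both sides are explicit fractions and ≤ is cross-multiplication.
  frac-dist-≤ : ∀ a b q K c → .{{_ : NonZero b}} → .{{_ : NonZero q}} → .{{_ : NonZero K}} →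
    ℤ.∣ a * q ⊖ b ∣ * K ≤ c * (b * q) → ℚ.∣ frac a b ℚ.- frac 1 q ∣ ℚ.≤ (ℤ.+ c ℚ./ 1) ℚ.* frac 1 K
  frac-dist-≤ a (suc b) (suc q) (suc K) c ineq =
    toℚᵘ-cancel-≤ (ℚᵘ.≤-respˡ-≃ (ℚᵘ.≃-sym lhs) (ℚᵘ.≤-respʳ-≃ (ℚᵘ.≃-sym rhs) (ℚᵘ.*≤* numerators)))
    where
    x y : ℚ
    x = frac a (suc b)
    y = frac 1 (suc q)
    x′ y′ z′ : ℚᵘ.ℚᵘ
    x′ = ℚᵘ.mkℚᵘ (ℤ.+ a) b
    y′ = ℚᵘ.mkℚᵘ (ℤ.+ 1) q
    z′ = ℚᵘ.mkℚᵘ (ℤ.+ 1) K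
    difference : ℤ.+ a ℤ.* ℤ.+ suc q ℤ.+ ℤ.- (ℤ.+ 1) ℤ.* ℤ.+ suc b ≡ a * suc q ⊖ suc b
    difference = trans (cong₂ ℤ._+_ (sym (ℤ.pos-* a (suc q))) (ℤ.-1*i≡-i (ℤ.+ suc b)))
                       (ℤ.m-n≡m⊖n (a * suc q) (suc b))
    numerators : ℤ.+ ℤ.∣ ℤ.+ a ℤ.* ℤ.+ suc q ℤ.+ ℤ.- (ℤ.+ 1) ℤ.* ℤ.+ suc b ∣ ℤ.* ℤ.+ (1 * suc K)
                 ℤ.≤ (ℤ.+ c ℤ.* ℤ.+ 1) ℤ.* ℤ.+ (suc b * suc q)
    numerators = subst₂ ℤ._≤_
      (trans (ℤ.pos-* ℤ.∣ a * suc q ⊖ suc b ∣ (1 * suc K))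
             (cong (λ z → ℤ.+ ℤ.∣ z ∣ ℤ.* ℤ.+ (1 * suc K)) (sym difference)))
      (trans (ℤ.pos-* c (suc b * suc q)) (cong (ℤ._* ℤ.+ (suc b * suc q)) (sym (ℤ.*-identityʳ (ℤ.+ c)))))
      (ℤ.+≤+ (subst (λ z → ℤ.∣ a * suc q ⊖ suc b ∣ * z ≤ c * (suc b * suc q))
                    (sym (*-identityˡ (suc K))) ineq))
    lhs : toℚᵘ ℚ.∣ x ℚ.- y ∣ ℚᵘ.≃ ℚᵘ.∣ x′ ℚᵘ.- y′ ∣
    lhs = ℚᵘ.≃-trans (toℚᵘ-homo-∣-∣ (x ℚ.- y)) (ℚᵘ.∣-∣-cong (ℚᵘ.≃-trans (toℚᵘ-homo-+ x (ℚ.- y))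
            (ℚᵘ.+-cong (toℚᵘ-fromℚᵘ x′) (ℚᵘ.≃-trans (toℚᵘ-homo‿- y) (ℚᵘ.-‿cong (toℚᵘ-fromℚᵘ y′))))))
    rhs : toℚᵘ ((ℤ.+ c ℚ./ 1) ℚ.* frac 1 (suc K)) ℚᵘ.≃ ℚᵘ.mkℚᵘ (ℤ.+ c) 0 ℚᵘ.* z′
    rhs = ℚᵘ.≃-trans (toℚᵘ-homo-* (ℤ.+ c ℚ./ 1) (frac 1 (suc K)))
            (ℚᵘ.*-cong (toℚᵘ-fromℚᵘ (ℚᵘ.mkℚᵘ (ℤ.+ c) 0)) (toℚᵘ-fromℚᵘ z′))

  -- Each of the K rows is off by at most p σ p, and K² ≤ 8 |I_K|.
  ρ-constant : ℕ → ℕ → ℚ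
  ρ-constant p σ = ℤ.+ (8 * (p * σ * p)) ℚ./ 1

  module _ {p σ} (1<p : 1 < p) (shift : UnitShift p σ) where

    private
      instance
        p-nonZero : NonZero p
        p-nonZero = >-nonZero (<-trans z<s 1<p)
        σ-nonZero : NonZero σ
        σ-nonZero = unitShift-nonZero 1<p shift

    ∣ρ-1/p∣≤ : ∀ K → 6 ≤ K → ℚ.∣ ρ p K ℚ.- frac 1 p ∣ ℚ.≤ ρ-constant p σ ℚ.* frac 1 K
    ∣ρ-1/p∣≤ K 6≤K = subst₂ (λ a b → ℚ.∣ frac a b ℚ.- frac 1 p ∣ ℚ.≤ ρ-constant p σ ℚ.* frac 1 K)
      (sym (length-divSet p K)) (sym (length-IK K))
      (frac-dist-≤ D N p K (8 * B) {{N-nonZero}} (begin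
        ℤ.∣ D * p ⊖ N ∣ * K  ≤⟨ *-monoˡ-≤ K (∣m⊖n∣≤ Dp≤N+KB N≤Dp+KB) ⟩
        K * B * K            ≡⟨ regroup K B ⟩
        B * (K * K)          ≤⟨ *-monoʳ-≤ B (K*K≤8*#IK K 6≤K) ⟩
        B * (8 * N)          ≡⟨ regroup′ B N ⟩
        8 * B * N            ≤⟨ *-monoʳ-≤ (8 * B) (m≤m*n N p) ⟩
        8 * B * (N * p)      ∎))
      where
      open ≤-Reasoning
      B N D : ℕ
      B = p * σ * p
      N = #IK K
      D = #divSet p K
      instance
        K-nonZero : NonZero K
        K-nonZero = >-nonZero (≤-trans (s≤s z≤n) 6≤K)
      N-nonZero : NonZero N
      N-nonZero = ≢-nonZero λ N≡0 →
        <⇒≱ (>-nonZero⁻¹ (K * K) {{m*n≢0 K K}}) (subst (λ n → K * K ≤ 8 * n) N≡0 (K*K≤8*#IK K 6≤K))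
      Dp≡∑pDₖ : D * p ≡ ∑[ k < K ] (p * #divSet-row p K k)
      Dp≡∑pDₖ = trans (*-comm D p) (sym (∑-distribˡ-* K p (#divSet-row p K)))
      Dp≤N+KB : D * p ≤ N + K * B
      Dp≤N+KB = subst (_≤ N + K * B) (sym Dp≡∑pDₖ)
        (∑-≤-+ K λ k → p*∑-χ-even-∣d≤ shift (suc k) (K ∸ suc k) 1)
      N≤Dp+KB : N ≤ D * p + K * B
      N≤Dp+KB = subst (λ x → N ≤ x + K * B) (sym Dp≡∑pDₖ)
        (∑-≤-+ K λ k → ∑-χ-even≤ shift (suc k) (K ∸ suc k) 1)
      regroup : ∀ K B → K * B * K ≡ B * (K * K)
      regroup = ℕ-Ring.solve-∀
      regroup′ : ∀ B N → B * (8 * N) ≡ 8 * B * N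
      regroup′ = ℕ-Ring.solve-∀

open import Data.Nat using (ℕ; _≥_; _<_; nonTrivial⇒n>1)
open import Data.Nat.Properties using (≤∧≢⇒<)
open import Data.Nat.Primality using (Prime; prime⇒nonTrivial)
open import Data.Product using (Σ; _,_)
open import Data.Rational using (ℚ; _≤_; _-_; _*_; ∣_∣)
open import Function using (_∘_)
open import Relation.Binary.PropositionalEquality using (_≢_; sym)
open Congruences using (∃-unitShift)
open Counting using (ρ-constant; ∣ρ-1/p∣≤)

lemma2 : (p : ℕ) → Prime p → p ≢ 2 →
    Σ ℚ (λ C → Σ ℕ (λ K₀ → (K : ℕ) → K ≥ K₀ → K ≥ 1 →
      ∣ ρ p K - frac 1 p ∣ ≤ C * frac 1 K))
lemma2 p pp p≢2 = let σ , shift = ∃-unitShift pp 2<p in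
  ρ-constant p σ , 6 , λ K K≥6 _ → ∣ρ-1/p∣≤ 1<p shift K K≥6
  where
  1<p : 1 < p
  1<p = nonTrivial⇒n>1 p {{prime⇒nonTrivial pp}}
  2<p : 2 < p
  2<p = ≤∧≢⇒< 1<p (p≢2 ∘ sym)
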